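{- Let $m\ge 3$ be an odd integer, let $\beta$ be a primitive 3rd root of unity in $\mathbb{F}_{2^{2m}}$, and let $v\in\mathbb{F}_{2^{2m}}^*$ satisfy $\mathrm{tr}_m^{2m}(\beta v)=0$ or $\mathrm{tr}_m^{2m}(\beta^2 v)=0$. Then the monomial $v\,x^{(2^{2m+1}-2^{m+1}+1)/5}$ (if $m\equiv 1\pmod 4$), respectively $v\,x^{(2^{2m}-2^{m+1}+2)/5}$ (if $m\equiv 3\pmod 4$), is a complete permutation polynomial over $\mathbb{F}_{2^{2m}}$.
   Context: A polynomial $f\in\mathbb{F}_Q[x]$ is a complete permutation polynomial over $\mathbb{F}_Q$ if both $f(x)$ and $f(x)+x$ induce bijections of $\mathbb{F}_Q$. $\mathrm{tr}_m^{2m}(x)=x+x^{2^m}$ is the relative trace from $\mathbb{F}_{2^{2m}}$ to $\mathbb{F}_{2^m}$. -}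

module Defs where

open import Data.Nat using (ℕ; zero; suc)
open import Data.Fin using (Fin)
open import Data.Product using (Σ; _×_; _,_)
open import Relation.Binary.PropositionalEquality using (_≡_)
open import Relation.Nullary using (¬_)
open import Function.Definitions using (Bijective)
open import Algebra.Structures using (IsCommutativeRing)

-- Finite fields of a given order are unique up to isomorphism, so
-- quantifying over all such records is the same as speaking of F_Q.
record FiniteField (Q : ℕ) : Set₁ where
  infixl 6 _+_
  infixl 7 _*_
  field
    Carrier : Set
    _+_ _*_ : Carrier → Carrier → Carrier
    -_      : Carrier → Carrier
    0# 1#   : Carrier
    isCommutativeRing : IsCommutativeRing _≡_ _+_ _*_ -_ 0# 1#
    0≢1     : ¬ (0# ≡ 1#)
    inverse : (x : Carrier) → ¬ (x ≡ 0#) → Σ Carrier (λ y → x * y ≡ 1#)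
    enum    : Fin Q → Carrier
    enum-bijective : Bijective _≡_ _≡_ enum

  _^_ : Carrier → ℕ → Carrier
  x ^ zero  = 1#
  x ^ suc n = x * (x ^ n)

  IsPermutation : (Carrier → Carrier) → Set
  IsPermutation f = Bijective _≡_ _≡_ f

  IsCompletePermutation : (Carrier → Carrier) → Set
  IsCompletePermutation f = IsPermutation f × IsPermutation (λ x → f x + x)

  IsPrimitiveCubeRoot : Carrier → Set
  IsPrimitiveCubeRoot β = (β ^ 3 ≡ 1#) × ¬ (β ≡ 1#)

  tr : ℕ → Carrier → Carrier
  tr m x = x + x ^ (2 Data.Nat.^ m)

-- exponents of Theorem 8 (both numerators are divisible by 5 in the relevant cases;
-- subtraction is written after the addition so truncated ∸ never truncates)
open import Data.Nat.DivMod using (_/_)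
module Exps where
  open Data.Nat using (_∸_) renaming (_+_ to _+ℕ_; _*_ to _*ℕ_; _^_ to _^ℕ_)
  d₁ : ℕ → ℕ
  d₁ m = ((2 ^ℕ (2 *ℕ m +ℕ 1) +ℕ 1) ∸ 2 ^ℕ (m +ℕ 1)) / 5
  d₂ : ℕ → ℕ
  d₂ m = ((2 ^ℕ (2 *ℕ m) +ℕ 2) ∸ 2 ^ℕ (m +ℕ 1)) / 5
open Exps public

{-# OPTIONS --safe #-}
-- Write q = 2^m and N x = x^(q+1) for the norm onto 𝔽q. Both exponents have the form
-- d = 1 + (q + 1)k, so g x = v·x^d + l·x (l = 0 for f, l = 1 for f + x) equals
-- x·(v·N(x)^k + l), and N(g x) depends on N x only. Writing N x = z⁵ (5 is invertible
-- modulo q − 1) this dependence becomes z ↦ N(v)·z for l = 0 and, because the trace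
-- condition on v forces N v = tr(v)², the Dickson polynomial z⁵ + T z³ + T² z with T = tr(v)
-- for l = 1. Both are injective on 𝔽q, the latter since for odd m the polynomial u² + u + 1
-- has absolute trace 1 on 𝔽q and so no root there; hence g is injective, and an injective
-- map of a finite field is bijective.
module Submission where

open import Defs
open import Algebra.Bundles using (CommutativeRing; CommutativeMonoid; RawRing)
open import Algebra.Solver.Ring.AlmostCommutativeRing using (fromCommutativeRing; _-Raw-AlmostCommutative⟶_)
open import Algebra.Structures using (IsCommutativeRing)
open import Data.Bool using (Bool; true; false; _xor_; _∧_; if_then_else_)
import Data.Bool.Properties as Bool
open import Data.Fin using (Fin; zero; suc; punchOut)
open import Data.Fin.Permutation using (Permutation; permutation)
import Data.Fin.Properties as Fin
open import Data.Maybe using (Maybe; just; nothing)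
open import Data.Nat using (ℕ; zero; suc; _≤_; _%_) renaming (_+_ to _+ℕ_; _*_ to _*ℕ_; _^_ to _^ℕ_)
import Data.Nat as ℕ
open import Data.Nat.DivMod using (_/_)
import Data.Nat.Properties as ℕ
open import Data.Product using (∃; _×_; _,_; proj₁; proj₂)
open import Data.Sum using (_⊎_; inj₁; inj₂)
open import Data.Vec.Functional using (removeAt)
open import Function.Base using (_∘_)
open import Function.Definitions using (Injective; Surjective)
open import Relation.Binary.Definitions using (DecidableEquality)
open import Relation.Binary.PropositionalEquality
open import Relation.Nullary using (¬_; yes; no; does)
import Relation.Nullary.Decidable as Dec
open import Relation.Nullary.Negation using (contradiction)

Fin-injective⇒surjective : ∀ {n} (f : Fin n → Fin n) → Injective _≡_ _≡_ f →
                           ∀ y → ∃ λ x → f x ≡ y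
Fin-injective⇒surjective {suc n} f f-injective y with Fin.any? (λ x → f x Fin.≟ y)
... | yes hit  = hit
... | no  miss = contradiction (Fin.injective⇒≤ skip-y-injective) ℕ.1+n≰n
  where
  y≢f : ∀ x → y ≢ f x
  y≢f x y≡fx = miss (x , sym y≡fx)

  skip-y : Fin (suc n) → Fin n
  skip-y x = punchOut (y≢f x)

  skip-y-injective : Injective _≡_ _≡_ skip-y
  skip-y-injective e = f-injective (Fin.punchOut-injective (y≢f _) (y≢f _) e)

module FieldProperties {Q : ℕ} (F : FiniteField Q) where
  open FiniteField F public
  open IsCommutativeRing isCommutativeRing public
    using ( +-assoc; +-comm; +-identityˡ; +-identityʳ; -‿inverseˡ; -‿inverseʳ
          ; *-assoc; *-comm; *-identityˡ; *-identityʳ; zeroˡ; zeroʳ )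

  commutativeRing : CommutativeRing _ _
  commutativeRing = record { isCommutativeRing = isCommutativeRing }

  open CommutativeRing commutativeRing public
    using (+-commutativeMonoid; *-commutativeMonoid; commutativeSemiring; semiring; +-group)

  index : Carrier → Fin Q
  index x = proj₁ (proj₂ enum-bijective x)

  enum-index : ∀ x → enum (index x) ≡ x
  enum-index x = proj₂ (proj₂ enum-bijective x) refl

  index-enum : ∀ i → index (enum i) ≡ i
  index-enum i = proj₁ enum-bijective (enum-index (enum i))

  index-injective : Injective _≡_ _≡_ index
  index-injective {x} {y} e = trans (sym (enum-index x)) (trans (cong enum e) (enum-index y))

  infix 4 _≟_
  _≟_ : DecidableEquality Carrier
  x ≟ y = Dec.map′ index-injective (cong index) (index x Fin.≟ index y)

  injective⇒bijective : ∀ {f} → Injective _≡_ _≡_ f → IsPermutation f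
  injective⇒bijective {f} f-injective = f-injective , surjective
    where
    f̂ : Fin Q → Fin Q
    f̂ i = index (f (enum i))

    f̂-injective : Injective _≡_ _≡_ f̂
    f̂-injective e = proj₁ enum-bijective (f-injective (index-injective e))

    surjective : Surjective _≡_ _≡_ f
    surjective y with Fin-injective⇒surjective f̂ f̂-injective (index y)
    ... | i , f̂i≡y = enum i , λ z≡ → trans (cong f z≡) (index-injective f̂i≡y)

  inv : (x : Carrier) → x ≢ 0# → Carrier
  inv x x≢0 = proj₁ (inverse x x≢0)

  *-inverseʳ : ∀ x (x≢0 : x ≢ 0#) → x * inv x x≢0 ≡ 1#
  *-inverseʳ x x≢0 = proj₂ (inverse x x≢0)

  *-cancelˡ : ∀ {a b c} → a ≢ 0# → a * b ≡ a * c → b ≡ c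
  *-cancelˡ {a} {b} {c} a≢0 ab≡ac = begin
    b                  ≡⟨ sym (*-identityˡ b) ⟩
    1# * b             ≡⟨ cong (_* b) (sym a⁻¹a≡1) ⟩
    (a⁻¹ * a) * b      ≡⟨ *-assoc _ _ _ ⟩
    a⁻¹ * (a * b)      ≡⟨ cong (a⁻¹ *_) ab≡ac ⟩
    a⁻¹ * (a * c)      ≡⟨ sym (*-assoc _ _ _) ⟩
    (a⁻¹ * a) * c      ≡⟨ cong (_* c) a⁻¹a≡1 ⟩
    1# * c             ≡⟨ *-identityˡ c ⟩
    c                  ∎
    where
    open ≡-Reasoning
    a⁻¹ : Carrier
    a⁻¹ = inv a a≢0
    a⁻¹a≡1 : a⁻¹ * a ≡ 1#
    a⁻¹a≡1 = trans (*-comm _ _) (*-inverseʳ a a≢0)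

  *-cancelʳ : ∀ {a b c} → c ≢ 0# → a * c ≡ b * c → a ≡ b
  *-cancelʳ c≢0 ac≡bc = *-cancelˡ c≢0 (trans (*-comm _ _) (trans ac≡bc (*-comm _ _)))

  *-≢0 : ∀ {a b} → a ≢ 0# → b ≢ 0# → a * b ≢ 0#
  *-≢0 {a} a≢0 b≢0 ab≡0 = b≢0 (*-cancelˡ a≢0 (trans ab≡0 (sym (zeroʳ a))))

  x*y≡0⇒x≡0∨y≡0 : ∀ {x y} → x * y ≡ 0# → x ≡ 0# ⊎ y ≡ 0#
  x*y≡0⇒x≡0∨y≡0 {x} {y} xy≡0 with x ≟ 0# | y ≟ 0#
  ... | yes x≡0 | _       = inj₁ x≡0
  ... | no _    | yes y≡0 = inj₂ y≡0
  ... | no x≢0  | no y≢0  = contradiction xy≡0 (*-≢0 x≢0 y≢0)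

  ^-≢0 : ∀ {x} n → x ≢ 0# → x ^ n ≢ 0#
  ^-≢0 zero    _   1≡0 = 0≢1 (sym 1≡0)
  ^-≢0 (suc n) x≢0     = *-≢0 x≢0 (^-≢0 n x≢0)

  ^≡0⇒≡0 : ∀ {x} n → x ^ n ≡ 0# → x ≡ 0#
  ^≡0⇒≡0 {x} n xⁿ≡0 with x ≟ 0#
  ... | yes x≡0 = x≡0
  ... | no  x≢0 = contradiction xⁿ≡0 (^-≢0 n x≢0)

  1^n≡1 : ∀ n → 1# ^ n ≡ 1#
  1^n≡1 zero    = refl
  1^n≡1 (suc n) = trans (*-identityˡ _) (1^n≡1 n)

  open import Algebra.Properties.CommutativeSemiring.Exp commutativeSemiring as Exp using ()

  ^≡Exp^ : ∀ x n → x ^ n ≡ x Exp.^ n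
  ^≡Exp^ x zero    = refl
  ^≡Exp^ x (suc n) = cong (x *_) (^≡Exp^ x n)

  ^-homo-* : ∀ x m n → x ^ (m +ℕ n) ≡ x ^ m * x ^ n
  ^-homo-* x m n rewrite ^≡Exp^ x (m +ℕ n) | ^≡Exp^ x m | ^≡Exp^ x n = Exp.^-homo-* x m n

  ^-assocʳ : ∀ x m n → (x ^ m) ^ n ≡ x ^ (m *ℕ n)
  ^-assocʳ x m n rewrite ^≡Exp^ (x ^ m) n | ^≡Exp^ x m | ^≡Exp^ x (m *ℕ n) = Exp.^-assocʳ x m n

  ^-distrib-* : ∀ x y n → (x * y) ^ n ≡ x ^ n * y ^ n
  ^-distrib-* x y n rewrite ^≡Exp^ (x * y) n | ^≡Exp^ x n | ^≡Exp^ y n = Exp.^-distrib-* x y n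

  ^-comm : ∀ x m n → (x ^ m) ^ n ≡ (x ^ n) ^ m
  ^-comm x m n = trans (^-assocʳ x m n) (trans (cong (x ^_) (ℕ.*-comm m n)) (sym (^-assocʳ x n m)))

  module _ {c ℓ} (M : CommutativeMonoid c ℓ) where
    open CommutativeMonoid M using (_≈_)
      renaming (Carrier to A; trans to ≈-trans; sym to ≈-sym; reflexive to ≈-reflexive)
    open import Algebra.Properties.CommutativeMonoid.Sum M using (sum; sum-permute; sum-cong-≗)

    sum-reindex : (h : Carrier → A) (f f⁻¹ : Carrier → Carrier) →
                  (∀ x → f (f⁻¹ x) ≡ x) → (∀ x → f⁻¹ (f x) ≡ x) →
                  sum (λ i → h (f (enum i))) ≈ sum (λ i → h (enum i))
    sum-reindex h f f⁻¹ ff⁻¹ f⁻¹f = ≈-trans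
      (≈-reflexive (sum-cong-≗ {Q} (λ i → cong h (sym (enum-index (f (enum i)))))))
      (≈-sym (sum-permute (λ i → h (enum i)) π))
      where
      conjugate : ∀ (g g⁻¹ : Carrier → Carrier) → (∀ x → g (g⁻¹ x) ≡ x) →
                  ∀ i → index (g (enum (index (g⁻¹ (enum i))))) ≡ i
      conjugate g g⁻¹ gg⁻¹ i = trans (cong (λ x → index (g x)) (enum-index (g⁻¹ (enum i))))
                               (trans (cong index (gg⁻¹ _)) (index-enum i))

      π : Permutation Q Q
      π = permutation (λ i → index (f (enum i))) (λ i → index (f⁻¹ (enum i)))
                      (conjugate f f⁻¹ ff⁻¹) (conjugate f⁻¹ f f⁻¹f)

  open import Algebra.Properties.Semiring.Mult semiring using (×-homo-1; ×1-homo-*) renaming (_×_ to _·_)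
  open import Algebra.Properties.Group +-group using (∙-cancelʳ)
  import Algebra.Properties.CommutativeMonoid.Sum +-commutativeMonoid as Σ
  import Algebra.Properties.CommutativeMonoid.Sum *-commutativeMonoid as Π

  Q·x≡0 : ∀ x → Q · x ≡ 0#
  Q·x≡0 x = ∙-cancelʳ (Σ.sum enum) _ _ (begin
    Q · x + Σ.sum enum                  ≡⟨ cong (_+ Σ.sum enum) (sym (Σ.sum-replicate Q)) ⟩
    Σ.sum {Q} (λ _ → x) + Σ.sum enum       ≡⟨ sym (Σ.∑-distrib-+ (λ _ → x) enum) ⟩
    Σ.sum {Q} (λ i → x + enum i)         ≡⟨ sum-reindex +-commutativeMonoid (λ y → y) (x +_) (- x +_) x+-x+ -x+x+ ⟩
    Σ.sum enum                          ≡⟨ sym (+-identityˡ _) ⟩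
    0# + Σ.sum enum                     ∎)
    where
    open ≡-Reasoning
    x+-x+ : ∀ y → x + (- x + y) ≡ y
    x+-x+ y = trans (sym (+-assoc _ _ _)) (trans (cong (_+ y) (-‿inverseʳ x)) (+-identityˡ y))
    -x+x+ : ∀ y → - x + (x + y) ≡ y
    -x+x+ y = trans (sym (+-assoc _ _ _)) (trans (cong (_+ y) (-‿inverseˡ x)) (+-identityˡ y))

  [p^n]·1≡[p·1]^n : ∀ p n → (p ^ℕ n) · 1# ≡ (p · 1#) ^ n
  [p^n]·1≡[p·1]^n p zero    = ×-homo-1 1#
  [p^n]·1≡[p·1]^n p (suc n) = trans (×1-homo-* p (p ^ℕ n)) (cong ((p · 1#) *_) ([p^n]·1≡[p·1]^n p n))

  characteristic : ∀ p n → Q ≡ p ^ℕ n → p · 1# ≡ 0#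
  characteristic p n refl = ^≡0⇒≡0 n (trans (sym ([p^n]·1≡[p·1]^n p n)) (Q·x≡0 1#))

  0^n≡0 : ∀ n .{{_ : ℕ.NonZero n}} → 0# ^ n ≡ 0#
  0^n≡0 (suc n) = zeroˡ _

  ifZero : Carrier → Carrier → Carrier → Carrier
  ifZero y a b = if does (y ≟ 0#) then a else b

  ifZero-0 : ∀ a b → ifZero 0# a b ≡ a
  ifZero-0 a b rewrite Dec.dec-true (0# ≟ 0#) refl = refl

  ifZero-≢0 : ∀ {y} a b → y ≢ 0# → ifZero y a b ≡ b
  ifZero-≢0 {y} a b y≢0 rewrite Dec.dec-false (y ≟ 0#) y≢0 = refl

  ∏-≢0 : ∀ {n} (h : Fin n → Carrier) → (∀ i → h i ≢ 0#) → Π.sum h ≢ 0#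
  ∏-≢0 {zero}  h _   1≡0 = 0≢1 (sym 1≡0)
  ∏-≢0 {suc n} h h≢0     = *-≢0 (h≢0 zero) (∏-≢0 (λ i → h (suc i)) (λ i → h≢0 (suc i)))

  ∏-single : ∀ {n} (h : Fin n → Carrier) i → (∀ j → j ≢ i → h j ≡ 1#) → Π.sum h ≡ h i
  ∏-single {suc n} h i h≡1 = begin
    Π.sum h                      ≡⟨ Π.sum-remove {i = i} h ⟩
    h i * Π.sum (removeAt h i)   ≡⟨ cong (h i *_) removed≡1 ⟩
    h i * 1#                     ≡⟨ *-identityʳ _ ⟩
    h i                          ∎
    where
    open ≡-Reasoning
    removed≡1 : Π.sum (removeAt h i) ≡ 1#
    removed≡1 = trans (Π.sum-cong-≗ {n} (λ j → h≡1 _ (Fin.punchInᵢ≢i i j))) (Π.sum-replicate-zero n)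

  -- Replacing 0 by 1 makes y ↦ x·y a permutation of factors up to the single
  -- correction factor x at y = 0, so x^Q · ∏ nonzero = x · ∏ nonzero.
  nonzero : Carrier → Carrier
  nonzero y = ifZero y 1# y

  nonzero-≢0 : ∀ y → nonzero y ≢ 0#
  nonzero-≢0 y with y ≟ 0#
  ... | yes refl = λ e → 0≢1 (sym (trans (sym (ifZero-0 1# 0#)) e))
  ... | no  y≢0  = λ e → y≢0 (trans (sym (ifZero-≢0 1# y y≢0)) e)

  x^Q≡x : ∀ x → x ^ Q ≡ x
  x^Q≡x x with x ≟ 0#
  ... | yes refl = 0^n≡0 Q {{Fin.nonZeroIndex (index 0#)}}
  ... | no  x≢0  = *-cancelʳ P≢0 (begin
    x ^ Q * P                                  ≡⟨ cong (_* P) (trans (^≡Exp^ x Q) (sym (Π.sum-replicate Q))) ⟩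
    Π.sum {Q} (λ _ → x) * P                    ≡⟨ sym (Π.∑-distrib-+ (λ _ → x) (λ i → nonzero (enum i))) ⟩
    Π.sum {Q} (λ i → x * nonzero (enum i))     ≡⟨ Π.sum-cong-≗ {Q} (λ i → sym (scale (enum i))) ⟩
    Π.sum {Q} (λ i → nonzero (x * enum i) * correction (enum i))
      ≡⟨ Π.∑-distrib-+ (λ i → nonzero (x * enum i)) (λ i → correction (enum i)) ⟩
    Π.sum {Q} (λ i → nonzero (x * enum i)) * Π.sum {Q} (λ i → correction (enum i))
      ≡⟨ cong₂ _*_ (sum-reindex *-commutativeMonoid nonzero (x *_) (x⁻¹ *_) x*x⁻¹* x⁻¹*x*) ∏correction ⟩
    P * x                                      ≡⟨ *-comm P x ⟩
    x * P                                      ∎)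
    where
    open ≡-Reasoning
    P : Carrier
    P = Π.sum {Q} (λ i → nonzero (enum i))
    P≢0 : P ≢ 0#
    P≢0 = ∏-≢0 (λ i → nonzero (enum i)) (λ i → nonzero-≢0 (enum i))

    x⁻¹ : Carrier
    x⁻¹ = inv x x≢0
    x*x⁻¹* : ∀ y → x * (x⁻¹ * y) ≡ y
    x*x⁻¹* y = trans (sym (*-assoc _ _ _)) (trans (cong (_* y) (*-inverseʳ x x≢0)) (*-identityˡ y))
    x⁻¹*x* : ∀ y → x⁻¹ * (x * y) ≡ y
    x⁻¹*x* y = trans (sym (*-assoc _ _ _))
                     (trans (cong (_* y) (trans (*-comm _ _) (*-inverseʳ x x≢0))) (*-identityˡ y))

    correction : Carrier → Carrier
    correction y = ifZero y x 1#

    scale : ∀ y → nonzero (x * y) * correction y ≡ x * nonzero y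
    scale y with y ≟ 0#
    ... | yes refl = begin
      nonzero (x * 0#) * correction 0#  ≡⟨ cong₂ _*_ (trans (cong nonzero (zeroʳ x)) (ifZero-0 1# 0#)) (ifZero-0 x 1#) ⟩
      1# * x                            ≡⟨ *-comm 1# x ⟩
      x * 1#                            ≡⟨ cong (x *_) (sym (ifZero-0 1# 0#)) ⟩
      x * nonzero 0#                    ∎
    ... | no y≢0 = begin
      nonzero (x * y) * correction y    ≡⟨ cong₂ _*_ (ifZero-≢0 1# _ (*-≢0 x≢0 y≢0)) (ifZero-≢0 x 1# y≢0) ⟩
      x * y * 1#                        ≡⟨ *-identityʳ _ ⟩
      x * y                             ≡⟨ cong (x *_) (sym (ifZero-≢0 1# y y≢0)) ⟩
      x * nonzero y                     ∎

    ∏correction : Π.sum {Q} (λ i → correction (enum i)) ≡ x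
    ∏correction = trans (∏-single (λ i → correction (enum i)) (index 0#) away-from-0)
                        (trans (cong correction (enum-index 0#)) (ifZero-0 x 1#))
      where
      away-from-0 : ∀ i → i ≢ index 0# → correction (enum i) ≡ 1#
      away-from-0 i i≢ = ifZero-≢0 x 1# (λ e → i≢ (trans (sym (index-enum i)) (cong index e)))

-- A ring solver whose coefficients live in 𝔽₂ = (Bool, xor, ∧): it proves the
-- polynomial identities that hold in characteristic 2, such as (x + y)² = x² + y².
module CharacteristicTwo {Q : ℕ} (F : FiniteField Q)
  (1+1≡0 : FiniteField._+_ F (FiniteField.1# F) (FiniteField.1# F) ≡ FiniteField.0# F) where
  open FieldProperties F
  open import Algebra.Properties.Group +-group using (inverseˡ-unique; ε⁻¹≈ε)

  𝔽₂ : RawRing _ _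
  𝔽₂ = record
    { Carrier = Bool ; _≈_ = _≡_ ; _+_ = _xor_ ; _*_ = _∧_ ; -_ = λ b → b ; 0# = false ; 1# = true }

  ⟦_⟧ : Bool → Carrier
  ⟦ true  ⟧ = 1#
  ⟦ false ⟧ = 0#

  ⟦⟧-homo-+ : ∀ a b → ⟦ a xor b ⟧ ≡ ⟦ a ⟧ + ⟦ b ⟧
  ⟦⟧-homo-+ true  true  = sym 1+1≡0
  ⟦⟧-homo-+ true  false = sym (+-identityʳ _)
  ⟦⟧-homo-+ false b     = sym (+-identityˡ _)

  ⟦⟧-homo-* : ∀ a b → ⟦ a ∧ b ⟧ ≡ ⟦ a ⟧ * ⟦ b ⟧
  ⟦⟧-homo-* true  true  = sym (*-identityˡ _)
  ⟦⟧-homo-* true  false = sym (zeroʳ _)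
  ⟦⟧-homo-* false b     = sym (zeroˡ _)

  ⟦⟧-homo-- : ∀ a → ⟦ a ⟧ ≡ - ⟦ a ⟧
  ⟦⟧-homo-- true  = inverseˡ-unique 1# 1# 1+1≡0
  ⟦⟧-homo-- false = sym ε⁻¹≈ε

  ⟦⟧-morphism : 𝔽₂ -Raw-AlmostCommutative⟶ fromCommutativeRing commutativeRing
  ⟦⟧-morphism = record
    { ⟦_⟧ = ⟦_⟧ ; +-homo = ⟦⟧-homo-+ ; *-homo = ⟦⟧-homo-* ; -‿homo = ⟦⟧-homo--
    ; 0-homo = refl ; 1-homo = refl }

  ⟦⟧-≟ : (a b : Bool) → Maybe (⟦ a ⟧ ≡ ⟦ b ⟧)
  ⟦⟧-≟ a b with a Bool.≟ b
  ... | yes a≡b = just (cong ⟦_⟧ a≡b)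
  ... | no  _   = nothing

  open import Algebra.Solver.Ring 𝔽₂ (fromCommutativeRing commutativeRing) ⟦⟧-morphism ⟦⟧-≟ public
    using (solve; _:+_; _:*_; _:^_; _:=_; con)

  x+x≡0 : ∀ x → x + x ≡ 0#
  x+x≡0 = solve 1 (λ x → x :+ x := con false) refl

  x+y≡0⇒x≡y : ∀ {x y} → x + y ≡ 0# → x ≡ y
  x+y≡0⇒x≡y {x} {y} x+y≡0 = begin
    x              ≡⟨ solve 2 (λ x y → x := (x :+ y) :+ y) refl x y ⟩
    (x + y) + y    ≡⟨ cong (_+ y) x+y≡0 ⟩
    0# + y         ≡⟨ +-identityˡ y ⟩
    y              ∎
    where open ≡-Reasoning

  frobenius : ∀ n x y → (x + y) ^ (2 ^ℕ n) ≡ x ^ (2 ^ℕ n) + y ^ (2 ^ℕ n)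
  frobenius zero    = solve 2 (λ x y → (x :+ y) :^ 1 := x :^ 1 :+ y :^ 1) refl
  frobenius (suc n) x y = begin
    (x + y) ^ (2 *ℕ 2 ^ℕ n)                   ≡⟨ sym (^-assocʳ (x + y) 2 (2 ^ℕ n)) ⟩
    ((x + y) ^ 2) ^ (2 ^ℕ n)                  ≡⟨ cong (_^ (2 ^ℕ n)) (solve 2 (λ x y → (x :+ y) :^ 2 := x :^ 2 :+ y :^ 2) refl x y) ⟩
    (x ^ 2 + y ^ 2) ^ (2 ^ℕ n)                ≡⟨ frobenius n (x ^ 2) (y ^ 2) ⟩
    (x ^ 2) ^ (2 ^ℕ n) + (y ^ 2) ^ (2 ^ℕ n)   ≡⟨ cong₂ _+_ (^-assocʳ x 2 (2 ^ℕ n)) (^-assocʳ y 2 (2 ^ℕ n)) ⟩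
    x ^ (2 *ℕ 2 ^ℕ n) + y ^ (2 *ℕ 2 ^ℕ n)     ∎
    where open ≡-Reasoning

-- For q = 2^m the exponent d = 1 + (q + 1)k gives x^d = x · N(x)^k with N the norm to 𝔽q,
-- while 5k + 2 ≡ 0 and 5(1 + e) ≡ 1 (mod q − 1): on 𝔽q, t ↦ t^(1+e) inverts t ↦ t^5.
record Admissible (q d : ℕ) : Set where
  field
    k e j j′           : ℕ
    d≡1+[1+q]k         : d ≡ suc (suc q *ℕ k)
    5k+2+j≡jq          : 5 *ℕ k +ℕ 2 +ℕ j ≡ j *ℕ q
    5[1+e]+j′≡1+j′q    : 5 *ℕ suc e +ℕ j′ ≡ 1 +ℕ j′ *ℕ q

module Exponents where
  open import Data.Nat using (_+_; _*_; _^_; _∸_)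
  open import Data.Nat.DivMod using (m≡m%n+[m/n]*n; m*n/n≡m)
  open import Data.Nat.Tactic.RingSolver using (solve)
  open import Data.List using (_∷_; [])

  16^i≡5r+1 : ∀ i → ∃ λ r → 16 ^ i ≡ 5 * r + 1
  16^i≡5r+1 zero    = 0 , refl
  16^i≡5r+1 (suc i) with r , 16^i≡5r+1 ← 16^i≡5r+1 i =
    16 * r + 3 , trans (cong (16 *_) 16^i≡5r+1) (solve (r ∷ []))

  2^m≡2^[m%4]*16^[m/4] : ∀ m → 2 ^ m ≡ 2 ^ (m % 4) * 16 ^ (m / 4)
  2^m≡2^[m%4]*16^[m/4] m = begin
    2 ^ m                       ≡⟨ cong (2 ^_) (m≡m%n+[m/n]*n m 4) ⟩
    2 ^ (m % 4 + m / 4 * 4)     ≡⟨ ℕ.^-distribˡ-+-* 2 (m % 4) (m / 4 * 4) ⟩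
    2 ^ (m % 4) * 2 ^ (m / 4 * 4) ≡⟨ cong (λ n → 2 ^ (m % 4) * 2 ^ n) (ℕ.*-comm (m / 4) 4) ⟩
    2 ^ (m % 4) * 2 ^ (4 * (m / 4)) ≡⟨ cong (2 ^ (m % 4) *_) (sym (ℕ.^-*-assoc 2 4 (m / 4))) ⟩
    2 ^ (m % 4) * 16 ^ (m / 4)  ∎
    where open ≡-Reasoning

  2^m≡2+10r : ∀ m → m % 4 ≡ 1 → ∃ λ r → 2 ^ m ≡ 2 + 10 * r
  2^m≡2+10r m m%4≡1 with r , 16^[m/4]≡5r+1 ← 16^i≡5r+1 (m / 4) =
    r , trans (2^m≡2^[m%4]*16^[m/4] m) (trans (cong₂ (λ a b → 2 ^ a * b) m%4≡1 16^[m/4]≡5r+1) (solve (r ∷ [])))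

  2^m≡8+40r : ∀ m → m % 4 ≡ 3 → ∃ λ r → 2 ^ m ≡ 8 + 40 * r
  2^m≡8+40r m m%4≡3 with r , 16^[m/4]≡5r+1 ← 16^i≡5r+1 (m / 4) =
    r , trans (2^m≡2^[m%4]*16^[m/4] m) (trans (cong₂ (λ a b → 2 ^ a * b) m%4≡3 16^[m/4]≡5r+1) (solve (r ∷ [])))

  [a∸b]/5≡X : ∀ a b X → a ≡ X * 5 + b → (a ∸ b) / 5 ≡ X
  [a∸b]/5≡X _ b X refl = trans (cong (_/ 5) (ℕ.m+n∸n≡m (X * 5) b)) (m*n/n≡m X 5)

  d₁[q] : ℕ → ℕ
  d₁[q] q = ((2 * (q * q) + 1) ∸ 2 * q) / 5

  d₂[q] : ℕ → ℕ
  d₂[q] q = ((q * q + 2) ∸ 2 * q) / 5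

  admissible₁ : ∀ r → Admissible (2 + 10 * r) (d₁[q] (2 + 10 * r))
  admissible₁ r = record
    { k = 4 * r ; e = 8 * r ; j = 2 ; j′ = 4
    ; d≡1+[1+q]k      = trans ([a∸b]/5≡X (2 * ((2 + 10 * r) * (2 + 10 * r)) + 1) (2 * (2 + 10 * r))
                                         (1 + 12 * r + 40 * r * r) (solve (r ∷ [])))
                              (solve (r ∷ []))
    ; 5k+2+j≡jq       = solve (r ∷ [])
    ; 5[1+e]+j′≡1+j′q = solve (r ∷ []) }

  admissible₂ : ∀ r → Admissible (8 + 40 * r) (d₂[q] (8 + 40 * r))
  admissible₂ r = record
    { k = 1 + 8 * r ; e = 2 + 16 * r ; j = 1 ; j′ = 2
    ; d≡1+[1+q]k      = trans ([a∸b]/5≡X ((8 + 40 * r) * (8 + 40 * r) + 2) (2 * (8 + 40 * r))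
                                         (10 + 112 * r + 320 * r * r) (solve (r ∷ [])))
                              (solve (r ∷ []))
    ; 5k+2+j≡jq       = solve (r ∷ [])
    ; 5[1+e]+j′≡1+j′q = solve (r ∷ []) }

  2^[m+1]≡2*2^m : ∀ m → 2 ^ (m + 1) ≡ 2 * 2 ^ m
  2^[m+1]≡2*2^m m = cong (2 ^_) (ℕ.+-comm m 1)

  2^[2m]≡2^m*2^m : ∀ m → 2 ^ (2 * m) ≡ 2 ^ m * 2 ^ m
  2^[2m]≡2^m*2^m m = trans (cong (λ n → 2 ^ (m + n)) (ℕ.+-identityʳ m)) (ℕ.^-distribˡ-+-* 2 m m)

  d₁≡d₁[q][2^m] : ∀ m → d₁ m ≡ d₁[q] (2 ^ m)
  d₁≡d₁[q][2^m] m = cong₂ (λ a b → ((a + 1) ∸ b) / 5)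
    (trans (2^[m+1]≡2*2^m (2 * m)) (cong (2 *_) (2^[2m]≡2^m*2^m m))) (2^[m+1]≡2*2^m m)

  d₂≡d₂[q][2^m] : ∀ m → d₂ m ≡ d₂[q] (2 ^ m)
  d₂≡d₂[q][2^m] m = cong₂ (λ a b → ((a + 2) ∸ b) / 5) (2^[2m]≡2^m*2^m m) (2^[m+1]≡2*2^m m)

  admissible-d₁ : ∀ m → m % 4 ≡ 1 → Admissible (2 ^ m) (d₁ m)
  admissible-d₁ m m%4≡1 with r , 2^m≡2+10r ← 2^m≡2+10r m m%4≡1
    rewrite d₁≡d₁[q][2^m] m | 2^m≡2+10r = admissible₁ r

  admissible-d₂ : ∀ m → m % 4 ≡ 3 → Admissible (2 ^ m) (d₂ m)
  admissible-d₂ m m%4≡3 with r , 2^m≡8+40r ← 2^m≡8+40r m m%4≡3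
    rewrite d₂≡d₂[q][2^m] m | 2^m≡8+40r = admissible₂ r

  m%2≡1⇒m≡1+2[m/2] : ∀ m → m % 2 ≡ 1 → m ≡ suc (2 * (m / 2))
  m%2≡1⇒m≡1+2[m/2] m m%2≡1 =
    trans (m≡m%n+[m/n]*n m 2) (cong₂ _+_ m%2≡1 (ℕ.*-comm (m / 2) 2))

  2^[1+2h]≡2+3s : ∀ h → ∃ λ s → 2 ^ suc (2 * h) ≡ 2 + 3 * s
  2^[1+2h]≡2+3s zero = 0 , refl
  2^[1+2h]≡2+3s (suc h) with s , 2^[1+2h]≡2+3s ← 2^[1+2h]≡2+3s h = 2 + 4 * s , (begin
    2 ^ suc (2 * suc h)        ≡⟨ cong (λ n → 2 ^ suc n) (ℕ.*-suc 2 h) ⟩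
    2 * (2 * 2 ^ suc (2 * h))  ≡⟨ cong (λ t → 2 * (2 * t)) 2^[1+2h]≡2+3s ⟩
    2 * (2 * (2 + 3 * s))      ≡⟨ solve (s ∷ []) ⟩
    2 + 3 * (2 + 4 * s)        ∎)
    where open ≡-Reasoning

open Exponents

module QuadraticExtension (m : ℕ) (F : FiniteField (2 ^ℕ (2 *ℕ m))) where
  open FieldProperties F public

  1+1≡0 : 1# + 1# ≡ 0#
  1+1≡0 = trans (cong (1# +_) (sym (+-identityʳ 1#))) (characteristic 2 (2 *ℕ m) refl)

  open CharacteristicTwo F 1+1≡0 public

  q : ℕ
  q = 2 ^ℕ m

  instance
    q≢0 : ℕ.NonZero q
    q≢0 = ℕ.m^n≢0 2 m

  x^q^q≡x : ∀ x → (x ^ q) ^ q ≡ x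
  x^q^q≡x x = trans (^-assocʳ x q q) (trans (cong (x ^_) (sym Q≡q*q)) (x^Q≡x x))
    where
    Q≡q*q : 2 ^ℕ (2 *ℕ m) ≡ q *ℕ q
    Q≡q*q = trans (ℕ.^-distribˡ-+-* 2 m (m +ℕ 0)) (cong (λ n → q *ℕ 2 ^ℕ n) (ℕ.+-identityʳ m))

  _∈𝔽q : Carrier → Set
  t ∈𝔽q = t ^ q ≡ t

  0∈𝔽q : 0# ∈𝔽q
  0∈𝔽q = 0^n≡0 q

  1∈𝔽q : 1# ∈𝔽q
  1∈𝔽q = 1^n≡1 q

  +-∈𝔽q : ∀ {a b} → a ∈𝔽q → b ∈𝔽q → (a + b) ∈𝔽q
  +-∈𝔽q {a} {b} a∈ b∈ = trans (frobenius m a b) (cong₂ _+_ a∈ b∈)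

  *-∈𝔽q : ∀ {a b} → a ∈𝔽q → b ∈𝔽q → (a * b) ∈𝔽q
  *-∈𝔽q {a} {b} a∈ b∈ = trans (^-distrib-* a b q) (cong₂ _*_ a∈ b∈)

  ^-∈𝔽q : ∀ {a} n → a ∈𝔽q → (a ^ n) ∈𝔽q
  ^-∈𝔽q {a} n a∈ = trans (^-comm a n q) (cong (_^ n) a∈)

  inv-∈𝔽q : ∀ {a} (a≢0 : a ≢ 0#) → a ∈𝔽q → inv a a≢0 ∈𝔽q
  inv-∈𝔽q {a} a≢0 a∈ = *-cancelˡ a≢0 (begin
    a * a⁻¹ ^ q       ≡⟨ cong (_* a⁻¹ ^ q) (sym a∈) ⟩
    a ^ q * a⁻¹ ^ q   ≡⟨ sym (^-distrib-* a a⁻¹ q) ⟩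
    (a * a⁻¹) ^ q     ≡⟨ cong (_^ q) (*-inverseʳ a a≢0) ⟩
    1# ^ q            ≡⟨ trans 1∈𝔽q (sym (*-inverseʳ a a≢0)) ⟩
    a * a⁻¹           ∎)
    where
    open ≡-Reasoning
    a⁻¹ : Carrier
    a⁻¹ = inv a a≢0

  ^-reduce : ∀ {t} a b j → t ∈𝔽q → t ≢ 0# → a +ℕ j ≡ b +ℕ j *ℕ q → t ^ a ≡ t ^ b
  ^-reduce {t} a b j t∈ t≢0 a+j≡b+jq = *-cancelʳ (^-≢0 j t≢0) (begin
    t ^ a * t ^ j            ≡⟨ sym (^-homo-* t a j) ⟩
    t ^ (a +ℕ j)             ≡⟨ cong (t ^_) a+j≡b+jq ⟩
    t ^ (b +ℕ j *ℕ q)        ≡⟨ ^-homo-* t b (j *ℕ q) ⟩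
    t ^ b * t ^ (j *ℕ q)     ≡⟨ cong (t ^ b *_) (sym (^-assocʳ t j q)) ⟩
    t ^ b * (t ^ j) ^ q      ≡⟨ cong (t ^ b *_) (^-∈𝔽q j t∈) ⟩
    t ^ b * t ^ j            ∎)
    where open ≡-Reasoning

  N : Carrier → Carrier
  N x = x * x ^ q

  N-∈𝔽q : ∀ x → N x ∈𝔽q
  N-∈𝔽q x = trans (^-distrib-* x (x ^ q) q) (trans (cong (x ^ q *_) (x^q^q≡x x)) (*-comm _ _))

  N-* : ∀ x y → N (x * y) ≡ N x * N y
  N-* x y = trans (cong ((x * y) *_) (^-distrib-* x y q))
    (solve 4 (λ x y xq yq → (x :* y) :* (xq :* yq) := (x :* xq) :* (y :* yq)) refl x y (x ^ q) (y ^ q))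

  N≡0⇒≡0 : ∀ {x} → N x ≡ 0# → x ≡ 0#
  N≡0⇒≡0 Nx≡0 with x*y≡0⇒x≡0∨y≡0 Nx≡0
  ... | inj₁ x≡0  = x≡0
  ... | inj₂ xq≡0 = ^≡0⇒≡0 q xq≡0

  tr-∈𝔽q : ∀ x → tr m x ∈𝔽q
  tr-∈𝔽q x = trans (frobenius m x (x ^ q)) (trans (cong (x ^ q +_) (x^q^q≡x x)) (+-comm _ _))

  Tr : ℕ → Carrier → Carrier
  Tr zero    u = 0#
  Tr (suc n) u = Tr n u + u ^ (2 ^ℕ n)

  Tr-0 : ∀ n → Tr n 0# ≡ 0#
  Tr-0 zero    = refl
  Tr-0 (suc n) = trans (cong₂ _+_ (Tr-0 n) (0^n≡0 (2 ^ℕ n) {{ℕ.m^n≢0 2 n}})) (+-identityˡ 0#)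

  Tr-+ : ∀ n a b → Tr n (a + b) ≡ Tr n a + Tr n b
  Tr-+ zero    a b = sym (+-identityˡ 0#)
  Tr-+ (suc n) a b = trans (cong₂ _+_ (Tr-+ n a b) (frobenius n a b))
    (solve 4 (λ A B a′ b′ → (A :+ B) :+ (a′ :+ b′) := (A :+ a′) :+ (B :+ b′)) refl
           (Tr n a) (Tr n b) (a ^ (2 ^ℕ n)) (b ^ (2 ^ℕ n)))

  Tr-[u²+u] : ∀ n u → Tr n (u ^ 2 + u) ≡ u ^ (2 ^ℕ n) + u
  Tr-[u²+u] zero    u = solve 1 (λ u → con false := u :^ 1 :+ u) refl u
  Tr-[u²+u] (suc n) u = begin
    Tr n (u ^ 2 + u) + (u ^ 2 + u) ^ (2 ^ℕ n)       ≡⟨ cong₂ _+_ (Tr-[u²+u] n u) (frobenius n (u ^ 2) u) ⟩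
    (u ^ (2 ^ℕ n) + u) + ((u ^ 2) ^ (2 ^ℕ n) + u ^ (2 ^ℕ n))
      ≡⟨ solve 3 (λ u U V → (U :+ u) :+ (V :+ U) := V :+ u) refl u (u ^ (2 ^ℕ n)) ((u ^ 2) ^ (2 ^ℕ n)) ⟩
    (u ^ 2) ^ (2 ^ℕ n) + u                            ≡⟨ cong (_+ u) (^-assocʳ u 2 (2 ^ℕ n)) ⟩
    u ^ (2 ^ℕ suc n) + u                              ∎
    where open ≡-Reasoning

  Tr-1-odd : ∀ h → Tr (suc (2 *ℕ h)) 1# ≡ 1#
  Tr-1-odd zero    = solve 0 (con false :+ con true :^ 1 := con true) refl
  Tr-1-odd (suc h) = begin
    Tr (suc (2 *ℕ suc h)) 1#           ≡⟨ cong (λ n → Tr (suc n) 1#) (ℕ.*-suc 2 h) ⟩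
    Tr (suc (suc (suc (2 *ℕ h)))) 1#   ≡⟨ Tr-2+-1 (suc (2 *ℕ h)) ⟩
    Tr (suc (2 *ℕ h)) 1#               ≡⟨ Tr-1-odd h ⟩
    1#                                 ∎
    where
    open ≡-Reasoning
    Tr-2+-1 : ∀ n → Tr (suc (suc n)) 1# ≡ Tr n 1#
    Tr-2+-1 n = trans (cong₂ (λ a b → Tr n 1# + a + b) (1^n≡1 (2 ^ℕ n)) (1^n≡1 (2 ^ℕ suc n)))
                      (solve 1 (λ t → t :+ con true :+ con true := t) refl (Tr n 1#))

  x*x≡x^2 : ∀ x → x * x ≡ x ^ 2
  x*x≡x^2 x = cong (x *_) (sym (*-identityʳ x))

  cube-root-≢0 : ∀ {β} → β ^ 3 ≡ 1# → β ≢ 0#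
  cube-root-≢0 {β} β³≡1 β≡0 = 0≢1 (trans (sym (zeroˡ (0# ^ 2))) (trans (cong (_^ 3) (sym β≡0)) β³≡1))

  [β²]²≡β : ∀ {β} → β ^ 3 ≡ 1# → (β ^ 2) ^ 2 ≡ β
  [β²]²≡β {β} β³≡1 = trans (solve 1 (λ b → (b :^ 2) :^ 2 := b :^ 3 :* b) refl β)
                           (trans (cong (_* β) β³≡1) (*-identityˡ β))

  primitive-cube-root⇒β²+β+1≡0 : ∀ {β} → IsPrimitiveCubeRoot β → β ^ 2 + β + 1# ≡ 0#
  primitive-cube-root⇒β²+β+1≡0 {β} (β³≡1 , β≢1)
    with x*y≡0⇒x≡0∨y≡0 (trans [β+1][β²+β+1]≡β³+1 (trans (cong (_+ 1#) β³≡1) 1+1≡0))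
    where
    [β+1][β²+β+1]≡β³+1 : (β + 1#) * (β ^ 2 + β + 1#) ≡ β ^ 3 + 1#
    [β+1][β²+β+1]≡β³+1 = solve 1 (λ b → (b :+ con true) :* (b :^ 2 :+ b :+ con true) := b :^ 3 :+ con true) refl β
  ... | inj₁ β+1≡0      = contradiction (x+y≡0⇒x≡y β+1≡0) β≢1
  ... | inj₂ β²+β+1≡0   = β²+β+1≡0

  v^q≡γv⇒N≡tr² : ∀ {γ v} → γ ^ 2 + γ + 1# ≡ 0# → v ^ q ≡ γ * v → N v ≡ tr m v ^ 2
  v^q≡γv⇒N≡tr² {γ} {v} γ²+γ+1≡0 v^q≡γv = begin
    v * v ^ q                                    ≡⟨ cong (v *_) v^q≡γv ⟩
    v * (γ * v)                                  ≡⟨ solve 2 (λ g v → v :* (g :* v) := (v :+ g :* v) :^ 2 :+ v :^ 2 :* (g :^ 2 :+ g :+ con true)) refl γ v ⟩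
    (v + γ * v) ^ 2 + v ^ 2 * (γ ^ 2 + γ + 1#)   ≡⟨ cong₂ (λ a b → (v + a) ^ 2 + v ^ 2 * b) (sym v^q≡γv) γ²+γ+1≡0 ⟩
    (v + v ^ q) ^ 2 + v ^ 2 * 0#                 ≡⟨ trans (cong ((v + v ^ q) ^ 2 +_) (zeroʳ _)) (+-identityʳ _) ⟩
    (v + v ^ q) ^ 2                              ∎
    where open ≡-Reasoning

  tr[δv]≡0⇒v^q≡γv : ∀ {δ γ v} → δ ≢ 0# → δ ^ q * γ ≡ δ → tr m (δ * v) ≡ 0# → v ^ q ≡ γ * v
  tr[δv]≡0⇒v^q≡γv {δ} {γ} {v} δ≢0 δ^qγ≡δ tr≡0 with x*y≡0⇒x≡0∨y≡0 δ[γv+v^q]≡0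
    where
    open ≡-Reasoning
    δ[γv+v^q]≡0 : δ * (γ * v + v ^ q) ≡ 0#
    δ[γv+v^q]≡0 = begin
      δ * (γ * v + v ^ q)                    ≡⟨ solve 4 (λ d g v V → d :* (g :* v :+ V) := g :* (d :* v) :+ d :* V) refl δ γ v (v ^ q) ⟩
      γ * (δ * v) + δ * v ^ q                ≡⟨ cong (λ t → γ * (δ * v) + t * v ^ q) (sym δ^qγ≡δ) ⟩
      γ * (δ * v) + δ ^ q * γ * v ^ q        ≡⟨ solve 4 (λ g dv D V → g :* dv :+ D :* g :* V := g :* (dv :+ D :* V)) refl γ (δ * v) (δ ^ q) (v ^ q) ⟩
      γ * (δ * v + δ ^ q * v ^ q)            ≡⟨ cong (λ t → γ * (δ * v + t)) (sym (^-distrib-* δ v q)) ⟩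
      γ * tr m (δ * v)                       ≡⟨ cong (γ *_) tr≡0 ⟩
      γ * 0#                                 ≡⟨ zeroʳ γ ⟩
      0#                                     ∎
  ... | inj₁ δ≡0         = contradiction δ≡0 δ≢0
  ... | inj₂ γv+v^q≡0    = sym (x+y≡0⇒x≡y γv+v^q≡0)

  -- g covers f (l = 0) and f + x (l = 1) at once.
  module TwistedMonomial {v l : Carrier} (l*l≡l : l * l ≡ l) (l∈𝔽q : l ∈𝔽q) {d} (adm : Admissible q d) where
    open Admissible adm

    g : Carrier → Carrier
    g x = v * x ^ d + l * x

    reduced : Carrier → Carrier
    reduced z = N v * z + l * tr m v * z ^ 3 + l * z ^ 5

    reduced-0 : reduced 0# ≡ 0#
    reduced-0 = solve 3 (λ a l T → a :* con false :+ l :* T :* con false :^ 3 :+ l :* con false :^ 5 := con false)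
                        refl (N v) l (tr m v)

    g≡x*[vNᵏ+l] : ∀ x → g x ≡ x * (v * N x ^ k + l)
    g≡x*[vNᵏ+l] x = begin
      v * x ^ d + l * x                ≡⟨ cong (λ n → v * x ^ n + l * x) d≡1+[1+q]k ⟩
      v * (x * x ^ (suc q *ℕ k)) + l * x ≡⟨ cong (λ t → v * (x * t) + l * x) (sym (^-assocʳ x (suc q) k)) ⟩
      v * (x * N x ^ k) + l * x        ≡⟨ solve 4 (λ v x n l → v :* (x :* n) :+ l :* x := x :* (v :* n :+ l)) refl v x (N x ^ k) l ⟩
      x * (v * N x ^ k + l)            ∎
      where open ≡-Reasoning

    N[vs+l] : ∀ {s} → s ∈𝔽q → N (v * s + l) ≡ N v * s ^ 2 + l * tr m v * s + l
    N[vs+l] {s} s∈ = begin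
      (v * s + l) * (v * s + l) ^ q      ≡⟨ cong ((v * s + l) *_) (trans (frobenius m (v * s) l) (cong₂ _+_ (^-distrib-* v s q) l∈𝔽q)) ⟩
      (v * s + l) * (v ^ q * s ^ q + l)  ≡⟨ cong (λ t → (v * s + l) * (v ^ q * t + l)) s∈ ⟩
      (v * s + l) * (v ^ q * s + l)      ≡⟨ solve 4 (λ v V s l → (v :* s :+ l) :* (V :* s :+ l) := (v :* V) :* s :^ 2 :+ l :* (v :+ V) :* s :+ l :* l) refl v (v ^ q) s l ⟩
      N v * s ^ 2 + l * tr m v * s + l * l ≡⟨ cong (N v * s ^ 2 + l * tr m v * s +_) l*l≡l ⟩
      N v * s ^ 2 + l * tr m v * s + l   ∎
      where open ≡-Reasoning

    ^5-inverse : ∀ {t} → t ∈𝔽q → (t ^ suc e) ^ 5 ≡ t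
    ^5-inverse {t} t∈ with t ≟ 0#
    ... | yes refl = trans (cong (_^ 5) (zeroˡ _)) (zeroˡ _)
    ... | no  t≢0  = begin
      (t ^ suc e) ^ 5    ≡⟨ ^-assocʳ t (suc e) 5 ⟩
      t ^ (suc e *ℕ 5)   ≡⟨ cong (t ^_) (ℕ.*-comm (suc e) 5) ⟩
      t ^ (5 *ℕ suc e)   ≡⟨ ^-reduce (5 *ℕ suc e) 1 j′ t∈ t≢0 5[1+e]+j′≡1+j′q ⟩
      t * 1#             ≡⟨ *-identityʳ t ⟩
      t                  ∎
      where open ≡-Reasoning

    -- Writing t = z⁵ with z = t^(1+e), the relation z^(5k) · z² = 1 turns the norm of g into a
    -- polynomial in z.
    reduced-form : ∀ {t} → t ∈𝔽q → t * (N v * (t ^ k) ^ 2 + l * tr m v * t ^ k + l) ≡ reduced (t ^ suc e)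
    reduced-form {t} t∈ with t ≟ 0#
    ... | yes refl = trans (zeroˡ _) (sym (trans (cong reduced (zeroˡ _)) reduced-0))
    ... | no  t≢0  = begin
      t * (a * (t ^ k) ^ 2 + T * t ^ k + l)
        ≡⟨ cong (λ t′ → t′ * (a * (t′ ^ k) ^ 2 + T * t′ ^ k + l)) (sym (^5-inverse t∈)) ⟩
      z ^ 5 * (a * ((z ^ 5) ^ k) ^ 2 + T * (z ^ 5) ^ k + l)
        ≡⟨ cong (λ W → z ^ 5 * (a * W ^ 2 + T * W + l)) (^-assocʳ z 5 k) ⟩
      z ^ 5 * (a * W ^ 2 + T * W + l)
        ≡⟨ solve 5 (λ a T l z W → z :^ 5 :* (a :* W :^ 2 :+ T :* W :+ l)
                                  := a :* z :* (W :* z :^ 2) :^ 2 :+ T :* z :^ 3 :* (W :* z :^ 2) :+ l :* z :^ 5)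
                   refl a T l z W ⟩
      a * z * (W * z ^ 2) ^ 2 + T * z ^ 3 * (W * z ^ 2) + l * z ^ 5
        ≡⟨ cong (λ u → a * z * u ^ 2 + T * z ^ 3 * u + l * z ^ 5) Wz²≡1 ⟩
      a * z * 1# ^ 2 + T * z ^ 3 * 1# + l * z ^ 5
        ≡⟨ solve 4 (λ a T l z → a :* z :* con true :^ 2 :+ T :* z :^ 3 :* con true :+ l :* z :^ 5
                                := a :* z :+ T :* z :^ 3 :+ l :* z :^ 5) refl a T l z ⟩
      reduced z ∎
      where
      open ≡-Reasoning
      a : Carrier
      a = N v
      T : Carrier
      T = l * tr m v
      z : Carrier
      z = t ^ suc e
      W : Carrier
      W = z ^ (5 *ℕ k)
      Wz²≡1 : W * z ^ 2 ≡ 1#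
      Wz²≡1 = trans (sym (^-homo-* z (5 *ℕ k) 2))
                    (^-reduce (5 *ℕ k +ℕ 2) 0 j (^-∈𝔽q (suc e) t∈) (^-≢0 (suc e) t≢0) 5k+2+j≡jq)

    N∘g≡reduced : ∀ x → N (g x) ≡ reduced (N x ^ suc e)
    N∘g≡reduced x = begin
      N (g x)                                  ≡⟨ cong N (g≡x*[vNᵏ+l] x) ⟩
      N (x * (v * N x ^ k + l))                ≡⟨ N-* x _ ⟩
      N x * N (v * N x ^ k + l)                ≡⟨ cong (N x *_) (N[vs+l] (^-∈𝔽q k (N-∈𝔽q x))) ⟩
      N x * (N v * (N x ^ k) ^ 2 + l * tr m v * N x ^ k + l) ≡⟨ reduced-form (N-∈𝔽q x) ⟩
      reduced (N x ^ suc e)                    ∎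
      where open ≡-Reasoning

    module _ (reduced-injective : ∀ {z z′} → z ∈𝔽q → z′ ∈𝔽q → reduced z ≡ reduced z′ → z ≡ z′) where

      g≡⇒N≡ : ∀ {x y} → g x ≡ g y → N x ≡ N y
      g≡⇒N≡ {x} {y} gx≡gy = begin
        N x                    ≡⟨ sym (^5-inverse (N-∈𝔽q x)) ⟩
        (N x ^ suc e) ^ 5      ≡⟨ cong (_^ 5) (reduced-injective (^-∈𝔽q (suc e) (N-∈𝔽q x)) (^-∈𝔽q (suc e) (N-∈𝔽q y))
                                    (trans (sym (N∘g≡reduced x)) (trans (cong N gx≡gy) (N∘g≡reduced y)))) ⟩
        (N y ^ suc e) ^ 5      ≡⟨ ^5-inverse (N-∈𝔽q y) ⟩
        N y                    ∎
        where open ≡-Reasoning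

      g≡0⇒≡0 : ∀ {x} → g x ≡ 0# → x ≡ 0#
      g≡0⇒≡0 {x} gx≡0 = N≡0⇒≡0 (^≡0⇒≡0 (suc e) (reduced-injective (^-∈𝔽q (suc e) (N-∈𝔽q x)) 0∈𝔽q (begin
        reduced (N x ^ suc e)  ≡⟨ sym (N∘g≡reduced x) ⟩
        N (g x)                ≡⟨ cong N gx≡0 ⟩
        N 0#                   ≡⟨ zeroˡ _ ⟩
        0#                     ≡⟨ sym reduced-0 ⟩
        reduced 0#             ∎)))
        where open ≡-Reasoning

      g-injective : Injective _≡_ _≡_ g
      g-injective {x} {y} gx≡gy with v * N x ^ k + l ≟ 0#
      ... | no  c≢0 = *-cancelʳ c≢0 (begin
        x * (v * N x ^ k + l)   ≡⟨ sym (g≡x*[vNᵏ+l] x) ⟩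
        g x                     ≡⟨ gx≡gy ⟩
        g y                     ≡⟨ g≡x*[vNᵏ+l] y ⟩
        y * (v * N y ^ k + l)   ≡⟨ cong (λ t → y * (v * t ^ k + l)) (sym (g≡⇒N≡ gx≡gy)) ⟩
        y * (v * N x ^ k + l)   ∎)
        where open ≡-Reasoning
      ... | yes c≡0 = trans x≡0 (sym (g≡0⇒≡0 (trans (sym gx≡gy) gx≡0)))
        where
        gx≡0 : g x ≡ 0#
        gx≡0 = trans (g≡x*[vNᵏ+l] x) (trans (cong (x *_) c≡0) (zeroʳ x))
        x≡0 : x ≡ 0#
        x≡0 = g≡0⇒≡0 gx≡0

  module OddDegree {h} (m≡1+2h : m ≡ suc (2 *ℕ h)) where

    u²+u+1≢0 : ∀ {u} → u ∈𝔽q → u ^ 2 + u + 1# ≢ 0#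
    u²+u+1≢0 {u} u∈ u²+u+1≡0 = 0≢1 (sym (begin
      1#                                     ≡⟨ sym (subst (λ n → Tr n 1# ≡ 1#) (sym m≡1+2h) (Tr-1-odd h)) ⟩
      Tr m 1#                                ≡⟨ cong (Tr m) (solve 1 (λ u → con true := (u :^ 2 :+ u :+ con true) :+ (u :^ 2 :+ u)) refl u) ⟩
      Tr m ((u ^ 2 + u + 1#) + (u ^ 2 + u))  ≡⟨ Tr-+ m _ _ ⟩
      Tr m (u ^ 2 + u + 1#) + Tr m (u ^ 2 + u) ≡⟨ cong₂ _+_ (trans (cong (Tr m) u²+u+1≡0) (Tr-0 m)) (Tr-[u²+u] m u) ⟩
      0# + (u ^ q + u)                       ≡⟨ cong (λ t → 0# + (t + u)) u∈ ⟩
      0# + (u + u)                           ≡⟨ trans (+-identityˡ _) (x+x≡0 u) ⟩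
      0#                                     ∎))
      where open ≡-Reasoning

    u²+u+1-at : ∀ u t → t ≡ 1# → u ^ 2 + u + 1# ≡ u ^ 2 + u * t + t ^ 2
    u²+u+1-at u t refl = solve 1 (λ u → u :^ 2 :+ u :+ con true := u :^ 2 :+ u :* con true :+ con true :^ 2) refl u

    D : Carrier → Carrier → Carrier
    D c z = z ^ 5 + c * z ^ 3 + c ^ 2 * z

    ΔD : Carrier → Carrier → Carrier → Carrier
    ΔD c x y = (x + y) ^ 4 + (x * y + c) * (x + y) ^ 2 + (x * y) ^ 2 + x * y * c + c ^ 2

    D-+ : ∀ c x y → D c x + D c y ≡ (x + y) * ΔD c x y
    D-+ = solve 3 (λ c x y →
      (x :^ 5 :+ c :* x :^ 3 :+ c :^ 2 :* x) :+ (y :^ 5 :+ c :* y :^ 3 :+ c :^ 2 :* y)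
      := (x :+ y) :* ((x :+ y) :^ 4 :+ (x :* y :+ c) :* (x :+ y) :^ 2 :+ (x :* y) :^ 2 :+ x :* y :* c :+ c :^ 2)) refl

    -- A zero of ΔD c x y with x ≠ y yields a root of u² + u + 1 in 𝔽q: u = x/(x + y)
    -- if x² + xy + y² = 0, and u = (c + (x + y)²)/(x² + xy + y²) otherwise.
    ΔD-≢0 : ∀ {c x y} → c ∈𝔽q → x ∈𝔽q → y ∈𝔽q → x + y ≢ 0# → ΔD c x y ≢ 0#
    ΔD-≢0 {c} {x} {y} c∈ x∈ y∈ s≢0 ΔD≡0 with x ^ 2 + x * y + y ^ 2 ≟ 0#
    ... | yes w≡0 = u²+u+1≢0 (*-∈𝔽q x∈ (inv-∈𝔽q s≢0 (+-∈𝔽q x∈ y∈))) (begin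
      (x * i) ^ 2 + x * i + 1#
        ≡⟨ u²+u+1-at (x * i) ((x + y) * i) (*-inverseʳ (x + y) s≢0) ⟩
      (x * i) ^ 2 + x * i * ((x + y) * i) + ((x + y) * i) ^ 2
        ≡⟨ solve 3 (λ x y i → (x :* i) :^ 2 :+ x :* i :* ((x :+ y) :* i) :+ ((x :+ y) :* i) :^ 2
                              := (x :^ 2 :+ x :* y :+ y :^ 2) :* i :^ 2) refl x y i ⟩
      (x ^ 2 + x * y + y ^ 2) * i ^ 2  ≡⟨ cong (_* i ^ 2) w≡0 ⟩
      0# * i ^ 2                       ≡⟨ zeroˡ _ ⟩
      0#                               ∎)
      where
      open ≡-Reasoning
      i : Carrier
      i = inv (x + y) s≢0
    ... | no w≢0 = u²+u+1≢0 (*-∈𝔽q (+-∈𝔽q c∈ (^-∈𝔽q 2 (+-∈𝔽q x∈ y∈))) (inv-∈𝔽q w≢0 w∈)) (begin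
      u ^ 2 + u + 1#                   ≡⟨ u²+u+1-at u (w * j) (*-inverseʳ w w≢0) ⟩
      u ^ 2 + u * (w * j) + (w * j) ^ 2
        ≡⟨ solve 4 (λ c x y j →
             ((c :+ (x :+ y) :^ 2) :* j) :^ 2 :+ ((c :+ (x :+ y) :^ 2) :* j) :* ((x :^ 2 :+ x :* y :+ y :^ 2) :* j)
               :+ ((x :^ 2 :+ x :* y :+ y :^ 2) :* j) :^ 2
             := ((x :+ y) :^ 4 :+ (x :* y :+ c) :* (x :+ y) :^ 2 :+ (x :* y) :^ 2 :+ x :* y :* c :+ c :^ 2) :* j :^ 2)
             refl c x y j ⟩
      ΔD c x y * j ^ 2                 ≡⟨ cong (_* j ^ 2) ΔD≡0 ⟩
      0# * j ^ 2                       ≡⟨ zeroˡ _ ⟩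
      0#                               ∎)
      where
      open ≡-Reasoning
      w : Carrier
      w = x ^ 2 + x * y + y ^ 2
      w∈ : w ∈𝔽q
      w∈ = +-∈𝔽q (+-∈𝔽q (^-∈𝔽q 2 x∈) (*-∈𝔽q x∈ y∈)) (^-∈𝔽q 2 y∈)
      j : Carrier
      j = inv w w≢0
      u : Carrier
      u = (c + (x + y) ^ 2) * j

    D-injective : ∀ {c x y} → c ∈𝔽q → x ∈𝔽q → y ∈𝔽q → D c x ≡ D c y → x ≡ y
    D-injective {c} {x} {y} c∈ x∈ y∈ Dx≡Dy with x ≟ y
    ... | yes x≡y = x≡y
    ... | no  x≢y with x*y≡0⇒x≡0∨y≡0 (trans (sym (D-+ c x y)) (trans (cong (_+ D c y) Dx≡Dy) (x+x≡0 _)))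
    ...   | inj₁ s≡0  = contradiction (x+y≡0⇒x≡y s≡0) x≢y
    ...   | inj₂ ΔD≡0 = contradiction ΔD≡0 (ΔD-≢0 c∈ x∈ y∈ (x≢y ∘ x+y≡0⇒x≡y))

    β^q≡β² : ∀ {β} → β ^ 3 ≡ 1# → β ^ q ≡ β ^ 2
    β^q≡β² {β} β³≡1 with s , 2^[1+2h]≡2+3s ← 2^[1+2h]≡2+3s h = begin
      β ^ q                   ≡⟨ cong (β ^_) (trans (cong (2 ^ℕ_) m≡1+2h) 2^[1+2h]≡2+3s) ⟩
      β ^ (2 +ℕ 3 *ℕ s)       ≡⟨ ^-homo-* β 2 (3 *ℕ s) ⟩
      β ^ 2 * β ^ (3 *ℕ s)    ≡⟨ cong (β ^ 2 *_) (trans (sym (^-assocʳ β 3 s)) (trans (cong (_^ s) β³≡1) (1^n≡1 s))) ⟩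
      β ^ 2 * 1#              ≡⟨ *-identityʳ _ ⟩
      β ^ 2                   ∎
      where open ≡-Reasoning

    N≡tr² : ∀ {β v} → IsPrimitiveCubeRoot β → tr m (β * v) ≡ 0# ⊎ tr m (β ^ 2 * v) ≡ 0# → N v ≡ tr m v ^ 2
    N≡tr² {β} β-primitive@(β³≡1 , _) (inj₁ tr≡0) =
      v^q≡γv⇒N≡tr² [β²]²+β²+1≡0 (tr[δv]≡0⇒v^q≡γv (cube-root-≢0 β³≡1) β^qβ²≡β tr≡0)
      where
      open ≡-Reasoning
      β^qβ²≡β : β ^ q * β ^ 2 ≡ β
      β^qβ²≡β = begin
        β ^ q * β ^ 2    ≡⟨ cong (_* β ^ 2) (β^q≡β² β³≡1) ⟩
        β ^ 2 * β ^ 2    ≡⟨ x*x≡x^2 (β ^ 2) ⟩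
        (β ^ 2) ^ 2      ≡⟨ [β²]²≡β β³≡1 ⟩
        β                ∎
      [β²]²+β²+1≡0 : (β ^ 2) ^ 2 + β ^ 2 + 1# ≡ 0#
      [β²]²+β²+1≡0 = begin
        (β ^ 2) ^ 2 + β ^ 2 + 1#   ≡⟨ cong (λ t → t + β ^ 2 + 1#) ([β²]²≡β β³≡1) ⟩
        β + β ^ 2 + 1#             ≡⟨ solve 1 (λ b → b :+ b :^ 2 :+ con true := b :^ 2 :+ b :+ con true) refl β ⟩
        β ^ 2 + β + 1#             ≡⟨ primitive-cube-root⇒β²+β+1≡0 β-primitive ⟩
        0#                         ∎
    N≡tr² {β} β-primitive@(β³≡1 , _) (inj₂ tr≡0) =
      v^q≡γv⇒N≡tr² (primitive-cube-root⇒β²+β+1≡0 β-primitive)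
                   (tr[δv]≡0⇒v^q≡γv (^-≢0 2 (cube-root-≢0 β³≡1)) [β²]^qβ≡β² tr≡0)
      where
      open ≡-Reasoning
      [β²]^qβ≡β² : (β ^ 2) ^ q * β ≡ β ^ 2
      [β²]^qβ≡β² = begin
        (β ^ 2) ^ q * β   ≡⟨ cong (_* β) (^-comm β 2 q) ⟩
        (β ^ q) ^ 2 * β   ≡⟨ cong (λ t → t ^ 2 * β) (β^q≡β² β³≡1) ⟩
        (β ^ 2) ^ 2 * β   ≡⟨ cong (_* β) ([β²]²≡β β³≡1) ⟩
        β * β             ≡⟨ x*x≡x^2 β ⟩
        β ^ 2             ∎

    twisted-complete : ∀ {v d} → v ≢ 0# → N v ≡ tr m v ^ 2 → Admissible q d →
                       IsCompletePermutation (λ x → v * x ^ d)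
    twisted-complete {v} {d} v≢0 Nv≡tr² adm =
      injective⇒bijective (λ e → T₀.g-injective reduced₀-injective (trans (g₀≡ _) (trans e (sym (g₀≡ _))))) ,
      injective⇒bijective (λ e → T₁.g-injective reduced₁-injective (trans (g₁≡ _) (trans e (sym (g₁≡ _)))))
      where
      module T₀ = TwistedMonomial {v} {0#} (zeroˡ 0#) 0∈𝔽q adm
      module T₁ = TwistedMonomial {v} {1#} (*-identityˡ 1#) 1∈𝔽q adm

      g₀≡ : ∀ x → T₀.g x ≡ v * x ^ d
      g₀≡ x = trans (cong (v * x ^ d +_) (zeroˡ x)) (+-identityʳ _)

      g₁≡ : ∀ x → T₁.g x ≡ v * x ^ d + x
      g₁≡ x = cong (v * x ^ d +_) (*-identityˡ x)

      reduced₀≡Nv* : ∀ z → T₀.reduced z ≡ N v * z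
      reduced₀≡Nv* = solve 3 (λ a T z → a :* z :+ con false :* T :* z :^ 3 :+ con false :* z :^ 5 := a :* z)
                             refl (N v) (tr m v)

      reduced₀-injective : ∀ {z z′} → z ∈𝔽q → z′ ∈𝔽q → T₀.reduced z ≡ T₀.reduced z′ → z ≡ z′
      reduced₀-injective {z} {z′} _ _ e =
        *-cancelˡ (v≢0 ∘ N≡0⇒≡0) (trans (sym (reduced₀≡Nv* z)) (trans e (reduced₀≡Nv* z′)))

      reduced₁≡D : ∀ z → T₁.reduced z ≡ D (tr m v) z
      reduced₁≡D z = trans (cong (λ a → a * z + 1# * tr m v * z ^ 3 + 1# * z ^ 5) Nv≡tr²)
        (solve 2 (λ T z → T :^ 2 :* z :+ con true :* T :* z :^ 3 :+ con true :* z :^ 5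
                          := z :^ 5 :+ T :* z :^ 3 :+ T :^ 2 :* z) refl (tr m v) z)

      reduced₁-injective : ∀ {z z′} → z ∈𝔽q → z′ ∈𝔽q → T₁.reduced z ≡ T₁.reduced z′ → z ≡ z′
      reduced₁-injective {z} {z′} z∈ z′∈ e =
        D-injective (tr-∈𝔽q v) z∈ z′∈ (trans (sym (reduced₁≡D z)) (trans e (reduced₁≡D z′)))

theorem8 : (m : ℕ) → 3 ≤ m → m % 2 ≡ 1 →
    (F : FiniteField (2 ^ℕ (2 *ℕ m))) →
    let open FiniteField F in
    (β v : Carrier) → IsPrimitiveCubeRoot β → ¬ (v ≡ 0#) →
    (tr m (β * v) ≡ 0# ⊎ tr m ((β ^ 2) * v) ≡ 0#) →
    (m % 4 ≡ 1 → IsCompletePermutation (λ x → v * (x ^ d₁ m)))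
    × (m % 4 ≡ 3 → IsCompletePermutation (λ x → v * (x ^ d₂ m)))
theorem8 m _ m%2≡1 F β v β-primitive v≢0 trace≡0 =
  (λ m%4≡1 → complete (admissible-d₁ m m%4≡1)) , (λ m%4≡3 → complete (admissible-d₂ m m%4≡3))
  where
  open QuadraticExtension m F
  open OddDegree {m / 2} (m%2≡1⇒m≡1+2[m/2] m m%2≡1)

  complete : ∀ {d} → Admissible q d → IsCompletePermutation (λ x → v * x ^ d)
  complete = twisted-complete v≢0 (N≡tr² β-primitive trace≡0)
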